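{- Let $Z\subseteq {}^\omega 2$ be a strong measure zero subset of the Cantor space, let $\langle J_i : i<\omega\rangle$ be an interval partition of $\omega$, and let $\{P_i : i<\omega\}$ be a family of infinitely many pairwise disjoint infinite subsets of $\omega$. Then there is a sequence $\langle s_j : j<\omega\rangle$ (with $s_j \in {}^{\bigcup_{i\le j}J_i}2$) such that for every natural number $k$ and every $x\in Z$ there is $j\in P_k$ with $x\upharpoonright \bigcup_{i\leqslant j} J_i = s_j$.
   Context: The Cantor space ${}^\omega 2$ carries the usual metric $d(x,y)=2^{ -\min\{n : x(n)\neq y(n)\}}$ (and $d(x,x)=0$). A set $Z\subseteq{}^\omega 2$ has strong measure zero if for every sequence $\langle\varepsilon_n : n<\omega\rangle$ of positive reals there are sets $U_n$ of diameter at most $\varepsilon_n$ with $Z\subseteq\bigcup_n U_n$; equivalently, for every sequence $\langle k_n:n<\omega\rangle$ of natural numbers there are finite binary strings $r_n$ of length $k_n$ such that every $x\in Z$ extends some $r_n$. An interval partition of $\omega$ is a partition of $\omega$ into consecutive finite nonempty intervals $J_0<J_1<\dots$. -}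

module Defs where

open import Data.Nat using (ℕ; zero; suc; _<_; _≤_)
open import Data.Bool using (Bool)
open import Data.Fin using (Fin; toℕ)
open import Data.Product using (Σ; ∃; _×_)
open import Relation.Binary.PropositionalEquality using (_≡_; _≢_)
open import Relation.Unary using (Pred)
open import Level using (0ℓ)
open import Data.Empty using (⊥)

Cantor : Set
Cantor = ℕ → Bool

Str : ℕ → Set
Str l = Fin l → Bool

Extends : Cantor → {l : ℕ} → Str l → Set
Extends x r = ∀ i → x (toℕ i) ≡ r i

-- Strong measure zero (combinatorial characterisation from the context):
-- for every sequence ⟨k_n⟩ there are strings r_n of length k_n such that
-- every x ∈ Z extends some r_n.
StrongMeasureZero : Pred Cantor 0ℓ → Set
StrongMeasureZero Z =
  (k : ℕ → ℕ) → Σ ((n : ℕ) → Str (k n)) λ r →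
    ∀ x → Z x → ∃ λ n → Extends x (r n)

record IntervalPartition : Set where
  field
    start      : ℕ → ℕ
    start-zero : start 0 ≡ 0
    start-mono : ∀ i → start i < start (suc i)

  J : ℕ → Pred ℕ 0ℓ
  J i m = start i ≤ m × m < start (suc i)

  -- ⋃_{i ≤ j} J_i = [0 , start (suc j)); its size:
  upTo : ℕ → ℕ
  upTo j = start (suc j)

Infinite : Pred ℕ 0ℓ → Set
Infinite P = ∀ n → ∃ λ m → n ≤ m × P m

PairwiseDisjoint : (ℕ → Pred ℕ 0ℓ) → Set
PairwiseDisjoint P = ∀ i k m → i ≢ k → P i m → P k m → ⊥

{-# OPTIONS --safe #-}
-- For each k choose elements e k 0 < e k 1 < … of P k, all at least k, and apply
-- strong measure zero once per k, with lengths |⋃_{i ≤ e k n} J_i|, to get strings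
-- r k n such that every x ∈ Z extends some r k n.  Disjointness of the P k means
-- that every j equals e k n for at most one pair (k , n); put s_j = r k n for that
-- pair and arbitrary otherwise.  Because k, n ≤ e k n, whether such a pair exists
-- is decidable, so s is definable constructively.
module Submission where

open import Defs
open import Data.Nat using (ℕ; zero; suc; _<_; _≤_; z≤n; s≤s)
open import Data.Nat.Properties
  using (_≟_; <-cmp; <-irrefl; <-trans; <⇒≤; ≤-refl; ≤-trans; m≤n⇒m<n∨m≡n; anyUpTo?)
open import Data.Bool using (false)
open import Data.Product using (Σ; ∃; _×_; _,_; proj₁; proj₂)
open import Data.Sum using (inj₁; inj₂)
open import Data.Empty using (⊥-elim)
open import Function.Definitions using (Injective)
open import Relation.Binary.Definitions using (Monotonic₁; tri<; tri≈; tri>)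
open import Relation.Binary.PropositionalEquality using (_≡_; refl; sym; cong; subst)
open import Relation.Nullary using (Dec; yes; no; contradiction)
open import Relation.Unary using (Pred)
open import Level using (0ℓ)

Extends-subst : ∀ {x : Cantor} {l l′} (eq : l ≡ l′) {t : Str l} →
                Extends x t → Extends x (subst Str eq t)
Extends-subst refl ext = ext

module StepIncreasing {f : ℕ → ℕ} (step : ∀ n → f n < f (suc n)) where

  strictMono : Monotonic₁ _<_ _<_ f
  strictMono {m} {suc n} (s≤s m≤n) with m≤n⇒m<n∨m≡n m≤n
  ... | inj₁ m<n  = <-trans (strictMono m<n) (step n)
  ... | inj₂ refl = step m

  injective : Injective _≡_ _≡_ f
  injective {m} {n} eq with <-cmp m n
  ... | tri< m<n _ _ = ⊥-elim (<-irrefl eq (strictMono m<n))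
  ... | tri≈ _ m≡n _ = m≡n
  ... | tri> _ _ n<m = ⊥-elim (<-irrefl (sym eq) (strictMono n<m))

  head≤ : ∀ n → f 0 ≤ f n
  head≤ zero    = ≤-refl
  head≤ (suc n) = <⇒≤ (strictMono (s≤s z≤n))

  index≤ : ∀ n → n ≤ f n
  index≤ zero    = z≤n
  index≤ (suc n) = ≤-trans (s≤s (index≤ n)) (step n)

module _ {P : Pred ℕ 0ℓ} (inf : Infinite P) where

  seqAbove : ℕ → ℕ → ℕ
  seqAbove b zero    = proj₁ (inf b)
  seqAbove b (suc n) = proj₁ (inf (suc (seqAbove b n)))

  seqAbove-∈ : ∀ b n → P (seqAbove b n)
  seqAbove-∈ b zero    = proj₂ (proj₂ (inf b))
  seqAbove-∈ b (suc n) = proj₂ (proj₂ (inf (suc (seqAbove b n))))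

  seqAbove-step : ∀ b n → seqAbove b n < seqAbove b (suc n)
  seqAbove-step b n = proj₁ (proj₂ (inf (suc (seqAbove b n))))

  seqAbove-≥ : ∀ b n → b ≤ seqAbove b n
  seqAbove-≥ b n = ≤-trans (proj₁ (proj₂ (inf b))) (StepIncreasing.head≤ (seqAbove-step b) n)

module DisjointSequences
  (e : ℕ → ℕ → ℕ)
  (step : ∀ k n → e k n < e k (suc n))
  (above : ∀ k n → k ≤ e k n)
  (disjoint : ∀ k k′ n n′ → e k n ≡ e k′ n′ → k ≡ k′)
  where

  Hit : ℕ → Set
  Hit j = ∃ λ k → k < suc j × ∃ λ n → n < suc j × e k n ≡ j

  hit? : ∀ j → Dec (Hit j)
  hit? j = anyUpTo? (λ k → anyUpTo? (λ n → e k n ≟ j) (suc j)) (suc j)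

  hit : ∀ k n → Hit (e k n)
  hit k n = k , s≤s (above k n) , n , s≤s (StepIncreasing.index≤ (step k) n) , refl

  hit-unique : ∀ k k′ n n′ → e k n ≡ e k′ n′ → k ≡ k′ × n ≡ n′
  hit-unique k k′ n n′ eq with disjoint k k′ n n′ eq
  ... | refl = refl , StepIncreasing.injective (step k) eq

module Construction
  (Z : Pred Cantor 0ℓ) (smz : StrongMeasureZero Z) (IP : IntervalPartition)
  (P : ℕ → Pred ℕ 0ℓ) (inf : ∀ i → Infinite (P i)) (disj : PairwiseDisjoint P)
  where

  open IntervalPartition IP using (upTo)

  e : ℕ → ℕ → ℕ
  e k = seqAbove (inf k) k

  e-disjoint : ∀ k k′ n n′ → e k n ≡ e k′ n′ → k ≡ k′
  e-disjoint k k′ n n′ eq with k ≟ k′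
  ... | yes k≡k′ = k≡k′
  ... | no k≢k′  = ⊥-elim (disj k k′ (e k′ n′) k≢k′
                     (subst (P k) eq (seqAbove-∈ (inf k) k n)) (seqAbove-∈ (inf k′) k′ n′))

  open DisjointSequences e (λ k → seqAbove-step (inf k) k) (λ k → seqAbove-≥ (inf k) k) e-disjoint

  r : ∀ k n → Str (upTo (e k n))
  r k = proj₁ (smz (λ n → upTo (e k n)))

  r-covers : ∀ k x → Z x → ∃ λ n → Extends x (r k n)
  r-covers k = proj₂ (smz (λ n → upTo (e k n)))

  guess : ∀ j → Dec (Hit j) → Str (upTo j)
  guess j (yes (k , _ , n , _ , eq)) = subst Str (cong upTo eq) (r k n)
  guess j (no _)                     = λ _ → false

  guess-hit : ∀ x k n (d : Dec (Hit (e k n))) → Extends x (r k n) → Extends x (guess (e k n) d)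
  guess-hit x k n (yes (k′ , _ , n′ , _ , eq)) ext with hit-unique k′ k n′ n eq
  ... | refl , refl = Extends-subst {x = x} (cong upTo eq) ext
  guess-hit x k n (no ¬hit) ext = contradiction (hit k n) ¬hit

  s : ∀ j → Str (upTo j)
  s j = guess j (hit? j)

  s-covers : ∀ k x → Z x → ∃ λ j → P k j × Extends x (s j)
  s-covers k x zx with r-covers k x zx
  ... | n , ext = e k n , seqAbove-∈ (inf k) k n , guess-hit x k n (hit? (e k n)) ext

mainTheorem2 : (Z : Pred Cantor 0ℓ) → StrongMeasureZero Z →
    (IP : IntervalPartition) →
    (P : ℕ → Pred ℕ 0ℓ) → (∀ i → Infinite (P i)) → PairwiseDisjoint P →
    Σ ((j : ℕ) → Str (IntervalPartition.start IP (suc j))) λ s →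
      ∀ (k : ℕ) (x : Cantor) → Z x →
        ∃ λ j → P k j × Extends x (s j)
mainTheorem2 Z smz IP P inf disj = s , s-covers
  where open Construction Z smz IP P inf disj
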